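{- Let $t$ be a $\lambda$-term. If $t$ is $\mathsf{shuf}$-normal then $\mathrm{mnf}(t)$ is $\mathsf{vsub}$-normal.
   Context: $\lambda$-terms: $t,u,s::= v\mid tu$, values $v::= x\mid \lambda x.t$, up to $\alpha$; $t\{x\leftarrow u\}$ capture-avoiding substitution. Shuffling calculus: balanced contexts $B::=\langle\cdot\rangle\mid tB\mid Bt\mid (\lambda x.B)t$; $\to_{\mathsf{shuf}}$ is the closure under balanced contexts of $((\lambda x.t)u)s\mapsto(\lambda x.ts)u$ ($x\notin\mathrm{fv}(s)$), $v((\lambda x.s)u)\mapsto(\lambda x.vs)u$ ($v$ a value, $x\notin\mathrm{fv}(v)$), and $(\lambda x.t)v\mapsto t\{x\leftarrow v\}$ ($v$ a value). $t$ is $\mathsf{shuf}$-normal if it has no $\to_{\mathsf{shuf}}$-step. Value substitution calculus: vsub-terms $t,u::= v\mid tu\mid t[x\leftarrow u]$, vsub-values $v::=x\mid\lambda x.t$; $t[x\leftarrow u]$ binds $x$ in $t$. Evaluation contexts $E::=\langle\cdot\rangle\mid tE\mid Et\mid E[x\leftarrow u]\mid t[x\leftarrow E]$; substitution contexts $L::=\langle\cdot\rangle\mid L[x\leftarrow u]$. $\to_{\mathtt m}$: closure under evaluation contexts of $L\langle\lambda x.t\rangle u\mapsto L\langle t[x\leftarrow u]\rangle$; $\to_{\mathtt e}$: closure of $t[x\leftarrow L\langle v\rangle]\mapsto L\langle t\{x\leftarrow v\}\rangle$ ($v$ vsub-value; bound variables of $L$ not free in $u$, resp. $t$); $\to_{\mathsf{vsub}}=\to_{\mathtt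 m}\cup\to_{\mathtt e}$. $\to_{\mathtt m}$ is terminating and confluent; $\mathrm{mnf}(t)$ denotes the unique $\mathtt m$-normal form of $t$. -}

module Defs where

open import Data.Nat using (ℕ; zero; suc)
open import Data.Fin using (Fin; zero; suc)
open import Data.Product using (∃)
open import Relation.Nullary using (¬_)
open import Relation.Binary.Construct.Closure.ReflexiveTransitive using (Star)

-- Well-scoped de Bruijn representation: terms are taken up to α by construction.
-- Term n / VTerm n : terms with at most n free variables (indices Fin n).

data Term (n : ℕ) : Set where
  var : Fin n → Term n
  lam : Term (suc n) → Term n
  app : Term n → Term n → Term n

data IsValue {n : ℕ} : Term n → Set where
  var-val : (x : Fin n) → IsValue (var x)
  lam-val : (t : Term (suc n)) → IsValue (lam t)

Ren : ℕ → ℕ → Set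
Ren n m = Fin n → Fin m

ext : ∀ {n m} → Ren n m → Ren (suc n) (suc m)
ext ρ zero    = zero
ext ρ (suc x) = suc (ρ x)

rename : ∀ {n m} → Ren n m → Term n → Term m
rename ρ (var x)   = var (ρ x)
rename ρ (lam t)   = lam (rename (ext ρ) t)
rename ρ (app t u) = app (rename ρ t) (rename ρ u)

wk : ∀ {n} → Term n → Term (suc n)
wk = rename suc

Sub : ℕ → ℕ → Set
Sub n m = Fin n → Term m

exts : ∀ {n m} → Sub n m → Sub (suc n) (suc m)
exts σ zero    = var zero
exts σ (suc x) = wk (σ x)

subst : ∀ {n m} → Sub n m → Term n → Term m
subst σ (var x)   = σ x
subst σ (lam t)   = lam (subst (exts σ) t)
subst σ (app t u) = app (subst σ t) (subst σ u)

single : ∀ {n} → Term n → Sub (suc n) n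
single u zero    = u
single u (suc x) = var x

_[_] : ∀ {n} → Term (suc n) → Term n → Term n
t [ u ] = subst (single u) t

-- Shuffling calculus, closed under balanced contexts
-- B ::= ⟨·⟩ | t B | B t | (λx.B) t
-- The side conditions x ∉ fv(s), x ∉ fv(v) are expressed by weakening.

data _→shuf_ {n : ℕ} : Term n → Term n → Set where
  σ1   : (t : Term (suc n)) (u s : Term n) →
         app (app (lam t) u) s →shuf app (lam (app t (wk s))) u
  σ3   : (v : Term n) → IsValue v → (s : Term (suc n)) (u : Term n) →
         app v (app (lam s) u) →shuf app (lam (app (wk v) s)) u
  βv   : (t : Term (suc n)) (v : Term n) → IsValue v →
         app (lam t) v →shuf (t [ v ])
  appL : ∀ {t t'} (u : Term n) → t →shuf t' → app t u →shuf app t' u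
  appR : ∀ {u u'} (t : Term n) → u →shuf u' → app t u →shuf app t u'
  lamB : ∀ {t t' : Term (suc n)} (u : Term n) →
         t →shuf t' → app (lam t) u →shuf app (lam t') u

ShufNormal : ∀ {n} → Term n → Set
ShufNormal t = ¬ ∃ (λ u → t →shuf u)

-- Value substitution calculus
-- es t u  represents  t[x ← u]  (x = index 0 of t)

data VTerm (n : ℕ) : Set where
  var : Fin n → VTerm n
  lam : VTerm (suc n) → VTerm n
  app : VTerm n → VTerm n → VTerm n
  es  : VTerm (suc n) → VTerm n → VTerm n

data IsVValue {n : ℕ} : VTerm n → Set where
  var-val : (x : Fin n) → IsVValue (var x)
  lam-val : (t : VTerm (suc n)) → IsVValue (lam t)

vrename : ∀ {n m} → Ren n m → VTerm n → VTerm m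
vrename ρ (var x)   = var (ρ x)
vrename ρ (lam t)   = lam (vrename (ext ρ) t)
vrename ρ (app t u) = app (vrename ρ t) (vrename ρ u)
vrename ρ (es t u)  = es (vrename (ext ρ) t) (vrename ρ u)

VSub : ℕ → ℕ → Set
VSub n m = Fin n → VTerm m

vexts : ∀ {n m} → VSub n m → VSub (suc n) (suc m)
vexts σ zero    = var zero
vexts σ (suc x) = vrename suc (σ x)

vsubst : ∀ {n m} → VSub n m → VTerm n → VTerm m
vsubst σ (var x)   = σ x
vsubst σ (lam t)   = lam (vsubst (vexts σ) t)
vsubst σ (app t u) = app (vsubst σ t) (vsubst σ u)
vsubst σ (es t u)  = es (vsubst (vexts σ) t) (vsubst σ u)

vsingle : ∀ {n} → VTerm n → VSub (suc n) n
vsingle u zero    = u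
vsingle u (suc x) = var x

_⟦_⟧ : ∀ {n} → VTerm (suc n) → VTerm n → VTerm n
t ⟦ u ⟧ = vsubst (vsingle u) t

-- Substitution contexts L ::= ⟨·⟩ | L[x ← u].
-- SCtx n m : the context lives in scope n, its hole in scope m.
data SCtx : ℕ → ℕ → Set where
  hole : ∀ {n} → SCtx n n
  _[←_] : ∀ {n m} → SCtx (suc n) m → VTerm n → SCtx n m

plug : ∀ {n m} → SCtx n m → VTerm m → VTerm n
plug hole       t = t
plug (L [← u ]) t = es (plug L t) u

-- the weakening induced by the binders of L
wkL : ∀ {n m} → SCtx n m → Ren n m
wkL hole       x = x
wkL (L [← u ]) x = wkL L (suc x)

-- multiplicative step, closed under evaluation contexts
-- E ::= ⟨·⟩ | t E | E t | E[x←u] | t[x←E]   (no reduction under λ)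
data _→m_ {n : ℕ} : VTerm n → VTerm n → Set where
  dB   : ∀ {m} (L : SCtx n m) (t : VTerm (suc m)) (u : VTerm n) →
         app (plug L (lam t)) u →m plug L (es t (vrename (wkL L) u))
  appL : ∀ {t t'} (u : VTerm n) → t →m t' → app t u →m app t' u
  appR : ∀ {u u'} (t : VTerm n) → u →m u' → app t u →m app t u'
  esL  : ∀ {t t' : VTerm (suc n)} (u : VTerm n) → t →m t' → es t u →m es t' u
  esR  : ∀ {u u'} (t : VTerm (suc n)) → u →m u' → es t u →m es t u'

data _→e_ {n : ℕ} : VTerm n → VTerm n → Set where
  sv   : ∀ {m} (t : VTerm (suc n)) (L : SCtx n m) (v : VTerm m) → IsVValue v →
         es t (plug L v) →e plug L ((vrename (ext (wkL L)) t) ⟦ v ⟧)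
  appL : ∀ {t t'} (u : VTerm n) → t →e t' → app t u →e app t' u
  appR : ∀ {u u'} (t : VTerm n) → u →e u' → app t u →e app t u'
  esL  : ∀ {t t' : VTerm (suc n)} (u : VTerm n) → t →e t' → es t u →e es t' u
  esR  : ∀ {u u'} (t : VTerm (suc n)) → u →e u' → es t u →e es t u'

data _→vsub_ {n : ℕ} : VTerm n → VTerm n → Set where
  m-step : ∀ {t u} → t →m u → t →vsub u
  e-step : ∀ {t u} → t →e u → t →vsub u

_→m*_ : ∀ {n} → VTerm n → VTerm n → Set
_→m*_ = Star _→m_

MNormal : ∀ {n} → VTerm n → Set
MNormal t = ¬ ∃ (λ u → t →m u)

VsubNormal : ∀ {n} → VTerm n → Set
VsubNormal t = ¬ ∃ (λ u → t →vsub u)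

⌜_⌝ : ∀ {n} → Term n → VTerm n
⌜ var x ⌝   = var x
⌜ lam t ⌝   = lam ⌜ t ⌝
⌜ app t u ⌝ = app ⌜ t ⌝ ⌜ u ⌝

-- u is "the" m-normal form of t (unique, since →m is confluent and terminating)
IsMnf : ∀ {n} → VTerm n → VTerm n → Set
IsMnf t u = (t →m* u) × MNormal u
  where open import Data.Product using (_×_)

module Submission where

-- Proof idea.  We single out a class of vsub-terms, the *frozen* ones,
-- together with the *inert* ones (applications whose head is a variable
-- applied to frozen arguments):
--
--   frozen ::= x | λx.t | inert | (λx.frozen) inert | frozen[x ← inert]
--
-- (1) The embedding of every shuf-normal λ-term is frozen: the absence of
--     βv-, σ1- and σ3-redexes says exactly that every argument of an
--     abstraction is an inert application.
-- (2) Frozen terms are closed under →m: the only multiplicative redexes are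
--     (λx.s) i, which turn into s[x ← i] with i inert.
-- (3) A frozen term has no →e step, since an explicit substitution only ever
--     holds an inert term, and an inert term is never of the form L⟨v⟩.
-- The theorem follows: mnf(t) is reached from ⌜t⌝ by →m steps, hence is
-- frozen, hence e-normal; it is m-normal by definition.

open import Defs
open import Data.Nat using (ℕ; suc)
open import Data.Fin using (zero; suc)
open import Data.Product using (_,_)
open import Data.Unit using (⊤; tt)
open import Data.Empty using (⊥; ⊥-elim)
open import Relation.Nullary using (¬_)
open import Relation.Binary.PropositionalEquality using (_≡_; refl; cong; cong₂; sym)
  renaming (subst to ≡-subst)
open import Relation.Binary.Construct.Closure.ReflexiveTransitive using (ε; _◅_)

private
  variable
    n m : ℕ

-- The invariant.  Abstractions are frozen whatever their body is, since
-- neither →m nor →e reduces under λ.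
mutual
  data Inert {n : ℕ} : VTerm n → Set where
    inert-var : ∀ {x d} → Frozen d → Inert (app (var x) d)
    inert-app : ∀ {c d} → Inert c → Frozen d → Inert (app c d)

  data Frozen {n : ℕ} : VTerm n → Set where
    frozen-var   : ∀ x → Frozen (var x)
    frozen-lam   : ∀ s → Frozen (lam s)
    frozen-inert : ∀ {u} → Inert u → Frozen u
    frozen-β     : ∀ {s i} → Frozen s → Inert i → Frozen (app (lam s) i)
    frozen-es    : ∀ {s i} → Frozen s → Inert i → Frozen (es s i)

normal-fun : {a b : Term n} → ShufNormal (app a b) → ShufNormal a
normal-fun {b = b} nf (_ , step) = nf (_ , appL b step)

normal-arg : {a b : Term n} → ShufNormal (app a b) → ShufNormal b
normal-arg {a = a} nf (_ , step) = nf (_ , appR a step)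

normal-body : {s : Term (suc n)} {b : Term n} → ShufNormal (app (lam s) b) → ShufNormal s
normal-body {b = b} nf (_ , step) = nf (_ , lamB b step)

IsAbs : Term n → Set
IsAbs (lam _) = ⊤
IsAbs _       = ⊥

σ1-blocked : {a b d : Term n} → ShufNormal (app (app a b) d) → ¬ IsAbs a
σ1-blocked {a = lam s} {b} {d} nf _ = nf (_ , σ1 s b d)

mutual
  frozen-embed : (t : Term n) → ShufNormal t → Frozen ⌜ t ⌝
  frozen-embed (var x)           _  = frozen-var x
  frozen-embed (lam s)           _  = frozen-lam ⌜ s ⌝
  frozen-embed (app (lam s) u)   nf = frozen-β (frozen-embed s (normal-body nf)) (inert-argument s u nf)
  frozen-embed (app (var x) d)   nf = frozen-inert (inert-embed (var x) d nf λ ())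
  frozen-embed (app (app a b) d) nf = frozen-inert (inert-embed (app a b) d nf λ ())

  inert-embed : (c d : Term n) → ShufNormal (app c d) → ¬ IsAbs c → Inert ⌜ app c d ⌝
  inert-embed (var x)   d nf _      = inert-var (frozen-embed d (normal-arg nf))
  inert-embed (lam _)   _ _  notAbs = ⊥-elim (notAbs tt)
  inert-embed (app a b) d nf _      =
    inert-app (inert-embed a b (normal-fun nf) (σ1-blocked nf)) (frozen-embed d (normal-arg nf))

  -- The argument of an abstraction in a normal term is neither a value (βv)
  -- nor a β-shaped application (σ3), so it is inert.
  inert-argument : (s : Term (suc n)) (u : Term n) → ShufNormal (app (lam s) u) → Inert ⌜ u ⌝
  inert-argument s (var y)         nf = ⊥-elim (nf (_ , βv s (var y) (var-val y)))
  inert-argument s (lam r)         nf = ⊥-elim (nf (_ , βv s (lam r) (lam-val r)))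
  inert-argument s (app (lam r) u) nf = ⊥-elim (nf (_ , σ3 (lam s) (lam-val s) r u))
  inert-argument s (app (var y) u) nf = inert-embed (var y) u (normal-arg nf) λ ()
  inert-argument s (app (app a b) u) nf = inert-embed (app a b) u (normal-arg nf) λ ()

-- Renaming along a pointwise identity renaming is the identity; needed because
-- a dB step with an empty context still renames its argument by wkL hole.
ext-id : {ρ : Ren n n} → (∀ x → ρ x ≡ x) → ∀ x → ext ρ x ≡ x
ext-id h zero    = refl
ext-id h (suc x) = cong suc (h x)

vrename-id : {ρ : Ren n n} → (∀ x → ρ x ≡ x) → (t : VTerm n) → vrename ρ t ≡ t
vrename-id h (var x)   = cong var (h x)
vrename-id h (lam t)   = cong lam (vrename-id (ext-id h) t)
vrename-id h (app t u) = cong₂ app (vrename-id h t) (vrename-id h u)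
vrename-id h (es t u)  = cong₂ es (vrename-id (ext-id h) t) (vrename-id h u)

inert-no-answer-head : (L : SCtx n m) {t : VTerm (suc m)} {u : VTerm n} →
                       ¬ Inert (app (plug L (lam t)) u)
inert-no-answer-head hole       (inert-app () _)
inert-no-answer-head (L [← x ]) (inert-app () _)

-- A frozen dB-redex has an empty substitution context and an inert argument.
frozen-dB : (L : SCtx n m) (t : VTerm (suc m)) (u : VTerm n) →
            Frozen (app (plug L (lam t)) u) → Frozen (plug L (es t (vrename (wkL L) u)))
frozen-dB hole       _ u (frozen-β fs iu)  =
  frozen-es fs (≡-subst Inert (sym (vrename-id (λ _ → refl) u)) iu)
frozen-dB hole       _ _ (frozen-inert i)  = ⊥-elim (inert-no-answer-head hole i)
frozen-dB (L [← x ]) _ _ (frozen-inert i)  = ⊥-elim (inert-no-answer-head (L [← x ]) i)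

mutual
  inert-→m : {u w : VTerm n} → Inert u → u →m w → Inert w
  inert-→m i                  (dB L _ _)    = ⊥-elim (inert-no-answer-head L i)
  inert-→m (inert-var _)      (appL _ ())
  inert-→m (inert-var fd)     (appR _ step) = inert-var (frozen-→m fd step)
  inert-→m (inert-app ic fd)  (appL _ step) = inert-app (inert-→m ic step) fd
  inert-→m (inert-app ic fd)  (appR _ step) = inert-app ic (frozen-→m fd step)

  frozen-→m : {u w : VTerm n} → Frozen u → u →m w → Frozen w
  frozen-→m f                 (dB L t u)    = frozen-dB L t u f
  frozen-→m (frozen-inert i)  step          = frozen-inert (inert-→m i step)
  frozen-→m (frozen-β _ _)    (appL _ ())
  frozen-→m (frozen-β fs ii)  (appR _ step) = frozen-β fs (inert-→m ii step)
  frozen-→m (frozen-es fs ii) (esL _ step)  = frozen-es (frozen-→m fs step) ii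
  frozen-→m (frozen-es fs ii) (esR _ step)  = frozen-es fs (inert-→m ii step)

frozen-→m* : {u w : VTerm n} → Frozen u → u →m* w → Frozen w
frozen-→m* f ε              = f
frozen-→m* f (step ◅ steps) = frozen-→m* (frozen-→m f step) steps

inert-no-answer : (L : SCtx n m) {v : VTerm m} → IsVValue v → ¬ Inert (plug L v)
inert-no-answer hole       (var-val x) ()
inert-no-answer hole       (lam-val t) ()
inert-no-answer (L [← x ]) _           ()

mutual
  inert-e-normal : {u w : VTerm n} → Inert u → ¬ (u →e w)
  inert-e-normal (inert-var _)     (appL _ ())
  inert-e-normal (inert-var fd)    (appR _ step) = frozen-e-normal fd step
  inert-e-normal (inert-app ic _)  (appL _ step) = inert-e-normal ic step
  inert-e-normal (inert-app _ fd)  (appR _ step) = frozen-e-normal fd step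

  frozen-e-normal : {u w : VTerm n} → Frozen u → ¬ (u →e w)
  frozen-e-normal (frozen-inert i)  step          = inert-e-normal i step
  frozen-e-normal (frozen-β _ _)    (appL _ ())
  frozen-e-normal (frozen-β _ ii)   (appR _ step) = inert-e-normal ii step
  frozen-e-normal (frozen-es _ ii)  (sv _ L _ v)  = inert-no-answer L v ii
  frozen-e-normal (frozen-es fs _)  (esL _ step)  = frozen-e-normal fs step
  frozen-e-normal (frozen-es _ ii)  (esR _ step)  = inert-e-normal ii step

lemma7 : ∀ {n} (t : Term n) → ShufNormal t →
    ∀ (u : VTerm n) → IsMnf ⌜ t ⌝ u → VsubNormal u
lemma7 _ _  _ (_     , m-normal) (w , m-step step) = m-normal (w , step)
lemma7 t nf _ (steps , _)        (_ , e-step step) =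
  frozen-e-normal (frozen-→m* (frozen-embed t nf) steps) step
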